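{- Let $G$ be a finite simple connected graph with $n$ vertices $v_1,\dots,v_n$. Then $$\sum_{i=1}^n \mu_i^2 \ge \frac{1}{n}\Big\{\sum_{i=1}^n |d_i-\mu_i|\Big\}^2 + M_1(G),$$ with equality if $G$ is regular or semiregular.
   Context: All graphs are finite, simple and connected with $n\ge 3$ vertices; $d_i$ is the degree of $v_i$ and $\mu_i$ is the average of the degrees of the vertices adjacent to $v_i$. The first Zagreb index is $M_1(G)=\sum_{i=1}^n d_i^2$. A graph is regular if all vertices have the same degree. A connected graph is bidegreed with degrees $\Delta>\delta$ if every vertex has degree $\Delta$ or $\delta$ and both occur; a semiregular graph is a connected bidegreed bipartite graph in which all vertices in the same part of the bipartition have the same degree. -}

module Defs where

open import Data.Nat using (ℕ; zero; suc; _>_)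
open import Data.Bool using (Bool; true; false; if_then_else_)
open import Data.Fin using (Fin)
open import Data.List using (List; map; foldr; allFin)
open import Data.Integer using (+_)
open import Data.Rational using (ℚ; 0ℚ; _+_; _*_; _-_; ∣_∣; _/_)
open import Data.Product using (Σ; ∃; _×_; _,_)
open import Relation.Binary.PropositionalEquality using (_≡_)
open import Data.Empty using (⊥)
open import Data.Sum using (_⊎_)

record Graph (n : ℕ) : Set where
  field
    adj    : Fin n → Fin n → Bool
    symm   : ∀ i j → adj i j ≡ adj j i
    irrefl : ∀ i → adj i i ≡ false
open Graph public

data Reach {n : ℕ} (G : Graph n) : Fin n → Fin n → Set where
  here : ∀ {i} → Reach G i i
  step : ∀ {i k j} → adj G i k ≡ true → Reach G k j → Reach G i j

Connected : {n : ℕ} → Graph n → Set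
Connected {n} G = ∀ (i j : Fin n) → Reach G i j

sumℕ : {n : ℕ} → (Fin n → ℕ) → ℕ
sumℕ {n} f = foldr Data.Nat._+_ 0 (map f (allFin n))

sumℚ : {n : ℕ} → (Fin n → ℚ) → ℚ
sumℚ {n} f = foldr _+_ 0ℚ (map f (allFin n))

degree : {n : ℕ} → Graph n → Fin n → ℕ
degree G i = sumℕ (λ j → if adj G i j then 1 else 0)

-- a / b as a rational; conventionally 0 when b = 0 (never used here:
-- in a connected graph with n ≥ 3 every degree is ≥ 1)
ratio : ℕ → ℕ → ℚ
ratio a zero    = 0ℚ
ratio a (suc b) = (+ a) / suc b

mu : {n : ℕ} → Graph n → Fin n → ℚ
mu G i = ratio (sumℕ (λ j → if adj G i j then degree G j else 0)) (degree G i)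

ℕtoℚ : ℕ → ℚ
ℕtoℚ a = (+ a) / 1

M1 : {n : ℕ} → Graph n → ℕ
M1 G = sumℕ (λ i → degree G i Data.Nat.* degree G i)

Regular : {n : ℕ} → Graph n → Set
Regular {n} G = ∃ λ k → ∀ (i : Fin n) → degree G i ≡ k

-- semiregular: connected bidegreed bipartite graph whose parts each have
-- constant degree.
Semiregular : {n : ℕ} → Graph n → Set
Semiregular {n} G =
  Connected G ×
  Σ (Fin n → Bool) λ side →
  Σ ℕ λ Δ → Σ ℕ λ δ →
    (Δ > δ) ×
    (∀ i j → adj G i j ≡ true → side i ≡ side j → ⊥) ×
    (∃ λ i → degree G i ≡ Δ) × (∃ λ j → degree G j ≡ δ) ×
    (∀ i → degree G i ≡ Δ ⊎ degree G i ≡ δ) ×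
    (∀ i j → side i ≡ side j → degree G i ≡ degree G j)

-- Double counting gives Σ d_i μ_i = Σ_i Σ_{j ~ i} d_j = Σ_j d_j² = M₁ (this needs every
-- d_i ≠ 0, which connectivity provides), hence Σ (d_i − μ_i)² = Σ μ_i² − 2M₁ + M₁ =
-- Σ μ_i² − M₁. The inequality is then the quadratic-mean/arithmetic-mean inequality
-- (Σ |x_i|)² / n ≤ Σ x_i² for x_i = d_i − μ_i, which is an equality as soon as all |x_i|
-- coincide: in a regular graph x_i = 0, in a semiregular one |x_i| = Δ − δ.
module Submission where

open import Defs
open import Data.Nat using (ℕ; _≥_)
open import Data.Sum using (_⊎_)
open import Data.Product using (_×_)
open import Relation.Binary.PropositionalEquality using (_≡_)
open import Data.Rational using (ℚ; _+_; _*_; _-_; ∣_∣; _≤_)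

open import Algebra.Bundles using (CommutativeRing)
import Algebra.Properties.Semiring.Sum as SemiringSum
open import Data.Bool using (Bool; true; false; if_then_else_; _≟_)
open import Data.Bool.Properties using (¬-not)
open import Data.Empty using (⊥; ⊥-elim)
open import Data.Fin using (Fin; zero; suc; punchIn)
open import Data.Fin.Properties using (punchInᵢ≢i)
import Data.Integer as ℤ
import Data.Integer.Properties as ℤₚ
import Data.Integer.Solver as ℤ-Solver
open import Data.List using (foldr; map; allFin; tabulate)
open import Data.List.Properties using (map-tabulate)
import Data.Nat as ℕ
open import Data.Nat using (NonZero; s≤s; z≤n)
import Data.Nat.Properties as ℕₚ
open import Data.Product using (∃; _,_)
open import Data.Rational using (0ℚ; 1ℚ; fromℚᵘ; toℚᵘ)
import Data.Rational.Properties as ℚₚ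
import Data.Rational.Solver as ℚ-Solver
import Data.Rational.Unnormalised as ℚᵘ
import Data.Rational.Unnormalised.Properties as ℚᵘₚ
open import Data.Sum using (inj₁; inj₂)
import Data.Vec.Functional as Vector
open import Function using (_∘_)
open import Relation.Binary.PropositionalEquality
  using (refl; sym; trans; cong; cong₂; subst; subst₂; _≢_; module ≡-Reasoning)
open import Relation.Nullary using (yes; no)

module ℕ-Sum = SemiringSum ℕₚ.+-*-semiring
module ℚ-Sum = SemiringSum (CommutativeRing.semiring ℚₚ.+-*-commutativeRing)
open ℚ-Sum using (sum-syntax; sum-cong-≗; ∑-distrib-+; *-distribʳ-sum)

foldr-tabulate : ∀ {A B : Set} (_∙_ : A → B → B) (ε : B) {n} (f : Fin n → A) →
                 foldr _∙_ ε (tabulate f) ≡ Vector.foldr _∙_ ε f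
foldr-tabulate _∙_ ε {ℕ.zero} f = refl
foldr-tabulate _∙_ ε {ℕ.suc n} f = cong (f zero ∙_) (foldr-tabulate _∙_ ε (f ∘ suc))

foldr-map-allFin : ∀ {A B : Set} (_∙_ : A → B → B) (ε : B) {n} (f : Fin n → A) →
                   foldr _∙_ ε (map f (allFin n)) ≡ Vector.foldr _∙_ ε f
foldr-map-allFin _∙_ ε f =
  trans (cong (foldr _∙_ ε) (map-tabulate (λ i → i) f)) (foldr-tabulate _∙_ ε f)

sumℕ≡sum : ∀ {n} (f : Fin n → ℕ) → sumℕ f ≡ ℕ-Sum.sum f
sumℕ≡sum = foldr-map-allFin ℕ._+_ 0

sumℕ-cong : ∀ {n} {f g : Fin n → ℕ} → (∀ i → f i ≡ g i) → sumℕ f ≡ sumℕ g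
sumℕ-cong {f = f} {g} f≗g = trans (sumℕ≡sum f) (trans (ℕ-Sum.sum-cong-≗ f≗g) (sym (sumℕ≡sum g)))

sumℚ≡sum : ∀ {n} (f : Fin n → ℚ) → sumℚ f ≡ ∑[ i < n ] f i
sumℚ≡sum = foldr-map-allFin _+_ 0ℚ

term≤sum : ∀ {n} (f : Fin n → ℕ) k → f k ℕ.≤ ℕ-Sum.sum f
term≤sum f zero    = ℕₚ.m≤m+n (f zero) _
term≤sum f (suc k) = ℕₚ.≤-trans (term≤sum (f ∘ suc) k) (ℕₚ.m≤n+m _ (f zero))

x≢z∧y≢z⇒x≡y : ∀ {x y z : Bool} → x ≢ z → y ≢ z → x ≡ y
x≢z∧y≢z⇒x≡y x≢z y≢z = trans (¬-not x≢z) (sym (¬-not y≢z))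

if-then-0≡*-if-then-1 : ∀ b x → (if b then x else 0) ≡ x ℕ.* (if b then 1 else 0)
if-then-0≡*-if-then-1 true  x = sym (ℕₚ.*-identityʳ x)
if-then-0≡*-if-then-1 false x = sym (ℕₚ.*-zeroʳ x)

fromℚᵘ-homo-+ : ∀ p q → fromℚᵘ (p ℚᵘ.+ q) ≡ fromℚᵘ p + fromℚᵘ q
fromℚᵘ-homo-+ p q = ℚₚ.toℚᵘ-injective (begin-equality
  toℚᵘ (fromℚᵘ (p ℚᵘ.+ q))                 ≃⟨ ℚₚ.toℚᵘ-fromℚᵘ (p ℚᵘ.+ q) ⟩
  p ℚᵘ.+ q                                 ≃⟨ ℚᵘₚ.+-cong (ℚₚ.toℚᵘ-fromℚᵘ p) (ℚₚ.toℚᵘ-fromℚᵘ q) ⟨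
  toℚᵘ (fromℚᵘ p) ℚᵘ.+ toℚᵘ (fromℚᵘ q)     ≃⟨ ℚₚ.toℚᵘ-homo-+ (fromℚᵘ p) (fromℚᵘ q) ⟨
  toℚᵘ (fromℚᵘ p + fromℚᵘ q)               ∎)
  where open ℚᵘₚ.≤-Reasoning

fromℚᵘ-homo-* : ∀ p q → fromℚᵘ (p ℚᵘ.* q) ≡ fromℚᵘ p * fromℚᵘ q
fromℚᵘ-homo-* p q = ℚₚ.toℚᵘ-injective (begin-equality
  toℚᵘ (fromℚᵘ (p ℚᵘ.* q))                 ≃⟨ ℚₚ.toℚᵘ-fromℚᵘ (p ℚᵘ.* q) ⟩
  p ℚᵘ.* q                                 ≃⟨ ℚᵘₚ.*-cong (ℚₚ.toℚᵘ-fromℚᵘ p) (ℚₚ.toℚᵘ-fromℚᵘ q) ⟨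
  toℚᵘ (fromℚᵘ p) ℚᵘ.* toℚᵘ (fromℚᵘ q)     ≃⟨ ℚₚ.toℚᵘ-homo-* (fromℚᵘ p) (fromℚᵘ q) ⟨
  toℚᵘ (fromℚᵘ p * fromℚᵘ q)               ∎)
  where open ℚᵘₚ.≤-Reasoning

ℕtoℚᵘ : ℕ → ℚᵘ.ℚᵘ
ℕtoℚᵘ a = ℚᵘ.mkℚᵘ (ℤ.+ a) 0

-- ℕtoℚ a and ratio a (suc b) are definitionally fromℚᵘ (ℕtoℚᵘ a) and fromℚᵘ (mkℚᵘ (+ a) b),
-- so each identity below reduces to one in ℤ.

ℕtoℚ-homo-+ : ∀ a b → ℕtoℚ (a ℕ.+ b) ≡ ℕtoℚ a + ℕtoℚ b
ℕtoℚ-homo-+ a b =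
  trans (ℚₚ.fromℚᵘ-cong {ℕtoℚᵘ (a ℕ.+ b)} {ℕtoℚᵘ a ℚᵘ.+ ℕtoℚᵘ b} (ℚᵘ.*≡* eq))
        (fromℚᵘ-homo-+ (ℕtoℚᵘ a) (ℕtoℚᵘ b))
  where
    open ℤ-Solver.+-*-Solver
    eq : ℤ.+ (a ℕ.+ b) ℤ.* ℤ.+ 1 ≡ (ℤ.+ a ℤ.* ℤ.+ 1 ℤ.+ ℤ.+ b ℤ.* ℤ.+ 1) ℤ.* ℤ.+ 1
    eq rewrite ℤₚ.pos-+ a b =
      solve 2 (λ x y → (x :+ y) :* con (ℤ.+ 1) := (x :* con (ℤ.+ 1) :+ y :* con (ℤ.+ 1)) :* con (ℤ.+ 1))
        refl (ℤ.+ a) (ℤ.+ b)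

ℕtoℚ-homo-* : ∀ a b → ℕtoℚ (a ℕ.* b) ≡ ℕtoℚ a * ℕtoℚ b
ℕtoℚ-homo-* a b =
  trans (ℚₚ.fromℚᵘ-cong {ℕtoℚᵘ (a ℕ.* b)} {ℕtoℚᵘ a ℚᵘ.* ℕtoℚᵘ b} (ℚᵘ.*≡* eq))
        (fromℚᵘ-homo-* (ℕtoℚᵘ a) (ℕtoℚᵘ b))
  where
    eq : ℤ.+ (a ℕ.* b) ℤ.* ℤ.+ 1 ≡ (ℤ.+ a ℤ.* ℤ.+ b) ℤ.* ℤ.+ 1
    eq = cong (ℤ._* ℤ.+ 1) (ℤₚ.pos-* a b)

ℕtoℚ-*-ratio : ∀ a d .{{_ : NonZero d}} → ℕtoℚ d * ratio a d ≡ ℕtoℚ a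
ℕtoℚ-*-ratio a (ℕ.suc b) =
  trans (sym (fromℚᵘ-homo-* (ℕtoℚᵘ (ℕ.suc b)) a/d)) (ℚₚ.fromℚᵘ-cong {ℕtoℚᵘ (ℕ.suc b) ℚᵘ.* a/d} {ℕtoℚᵘ a} (ℚᵘ.*≡* eq))
  where
    a/d : ℚᵘ.ℚᵘ
    a/d = ℚᵘ.mkℚᵘ (ℤ.+ a) b
    open ℤ-Solver.+-*-Solver
    eq : (ℤ.+ ℕ.suc b ℤ.* ℤ.+ a) ℤ.* ℤ.+ 1 ≡ ℤ.+ a ℤ.* (ℤ.+ 1 ℤ.* ℤ.+ ℕ.suc b)
    eq = solve 2 (λ x y → (x :* y) :* con (ℤ.+ 1) := y :* (con (ℤ.+ 1) :* x)) refl (ℤ.+ ℕ.suc b) (ℤ.+ a)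

ratio-*-cancel : ∀ k d .{{_ : NonZero d}} → ratio (k ℕ.* d) d ≡ ℕtoℚ k
ratio-*-cancel k (ℕ.suc b) = ℚₚ.fromℚᵘ-cong {ℚᵘ.mkℚᵘ (ℤ.+ (k ℕ.* ℕ.suc b)) b} {ℕtoℚᵘ k} (ℚᵘ.*≡* eq)
  where
    eq : ℤ.+ (k ℕ.* ℕ.suc b) ℤ.* ℤ.+ 1 ≡ ℤ.+ k ℤ.* ℤ.+ ℕ.suc b
    eq = trans (ℤₚ.*-identityʳ _) (ℤₚ.pos-* k (ℕ.suc b))

ℕtoℚ-sum : ∀ {n} (f : Fin n → ℕ) → ℕtoℚ (ℕ-Sum.sum f) ≡ ∑[ i < n ] ℕtoℚ (f i)
ℕtoℚ-sum {ℕ.zero}  f = refl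
ℕtoℚ-sum {ℕ.suc n} f = trans (ℕtoℚ-homo-+ (f zero) _) (cong (ℕtoℚ (f zero) +_) (ℕtoℚ-sum (f ∘ suc)))

∣p∣*∣p∣≡p*p : ∀ p → ∣ p ∣ * ∣ p ∣ ≡ p * p
∣p∣*∣p∣≡p*p p with ℚₚ.∣p∣≡p∨∣p∣≡-p p
... | inj₁ ∣p∣≡p  = cong (λ q → q * q) ∣p∣≡p
... | inj₂ ∣p∣≡-p = trans (cong (λ q → q * q) ∣p∣≡-p) (solve 1 (λ q → (:- q) :* (:- q) := q :* q) refl p)
  where open ℚ-Solver.+-*-Solver

0≤p*p : ∀ p → 0ℚ ≤ p * p
0≤p*p p = subst (0ℚ ≤_) (trans (ℚₚ.∣p*q∣≡∣p∣*∣q∣ p p) (∣p∣*∣p∣≡p*p p)) (ℚₚ.0≤∣p∣ (p * p))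

∣p-q∣≡∣q-p∣ : ∀ p q → ∣ p - q ∣ ≡ ∣ q - p ∣
∣p-q∣≡∣q-p∣ p q = trans (cong ∣_∣ (solve 2 (λ p q → p :- q := :- (q :- p)) refl p q)) (ℚₚ.∣-p∣≡∣p∣ (q - p))
  where open ℚ-Solver.+-*-Solver

x+[y+y]≡z+y⇒z≡x+y : ∀ x y z → x + (y + y) ≡ z + y → z ≡ x + y
x+[y+y]≡z+y⇒z≡x+y x y z eq = begin
  z                  ≡⟨ solve 2 (λ y z → z := (z :+ y) :- y) refl y z ⟩
  (z + y) - y        ≡⟨ cong (_- y) eq ⟨
  (x + (y + y)) - y  ≡⟨ solve 2 (λ x y → (x :+ (y :+ y)) :- y := x :+ y) refl x y ⟩
  x + y              ∎
  where open ≡-Reasoning; open ℚ-Solver.+-*-Solver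

sum-const : ∀ n c → ∑[ i < n ] c ≡ ℕtoℚ n * c
sum-const ℕ.zero    c = sym (ℚₚ.*-zeroˡ c)
sum-const (ℕ.suc n) c = begin
  c + ∑[ i < n ] c        ≡⟨ cong (c +_) (sum-const n c) ⟩
  c + ℕtoℚ n * c          ≡⟨ solve 2 (λ c N → c :+ N :* c := (con 1ℚ :+ N) :* c) refl c (ℕtoℚ n) ⟩
  (1ℚ + ℕtoℚ n) * c       ≡⟨ cong (_* c) (ℕtoℚ-homo-+ 1 n) ⟨
  ℕtoℚ (ℕ.suc n) * c      ∎
  where open ≡-Reasoning; open ℚ-Solver.+-*-Solver

sum-nonNeg : ∀ {n} (f : Fin n → ℚ) → (∀ i → 0ℚ ≤ f i) → 0ℚ ≤ ∑[ i < n ] f i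
sum-nonNeg {ℕ.zero}  f 0≤f = ℚₚ.≤-refl
sum-nonNeg {ℕ.suc n} f 0≤f = ℚₚ.+-mono-≤ (0≤f zero) (sum-nonNeg (f ∘ suc) (0≤f ∘ suc))

sum-square-sub : ∀ {n} (x y : Fin n → ℚ) →
  ∑[ i < n ] ((x i - y i) * (x i - y i)) + (∑[ i < n ] (x i * y i) + ∑[ i < n ] (x i * y i))
    ≡ ∑[ i < n ] (x i * x i) + ∑[ i < n ] (y i * y i)
sum-square-sub {n} x y = begin
  ∑[ i < n ] ((x i - y i) * (x i - y i)) + (∑[ i < n ] (x i * y i) + ∑[ i < n ] (x i * y i))
    ≡⟨ cong (∑[ i < n ] ((x i - y i) * (x i - y i)) +_) (∑-distrib-+ (λ i → x i * y i) (λ i → x i * y i)) ⟨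
  ∑[ i < n ] ((x i - y i) * (x i - y i)) + ∑[ i < n ] (x i * y i + x i * y i)
    ≡⟨ ∑-distrib-+ (λ i → (x i - y i) * (x i - y i)) (λ i → x i * y i + x i * y i) ⟨
  ∑[ i < n ] ((x i - y i) * (x i - y i) + (x i * y i + x i * y i))
    ≡⟨ sum-cong-≗ (λ i → expand (x i) (y i)) ⟩
  ∑[ i < n ] (x i * x i + y i * y i)
    ≡⟨ ∑-distrib-+ (λ i → x i * x i) (λ i → y i * y i) ⟩
  ∑[ i < n ] (x i * x i) + ∑[ i < n ] (y i * y i)
    ∎
  where
    open ≡-Reasoning
    open ℚ-Solver.+-*-Solver
    expand : ∀ a b → (a - b) * (a - b) + (a * b + a * b) ≡ a * a + b * b
    expand = solve 2 (λ a b → (a :- b) :* (a :- b) :+ (a :* b :+ a :* b) := a :* a :+ b :* b) refl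

sum-squares≡sum-squares-about-mean : ∀ {n} .{{_ : NonZero n}} (a : Fin n → ℚ) →
  let S = ∑[ i < n ] a i ; m = ratio 1 n * S in
  ∑[ i < n ] (a i * a i) ≡ ∑[ i < n ] ((a i - m) * (a i - m)) + S * m
sum-squares≡sum-squares-about-mean {n} a =
  x+[y+y]≡z+y⇒z≡x+y D (S * m) (∑[ i < n ] (a i * a i)) (begin
    D + (S * m + S * m)
      ≡⟨ cong (λ t → D + (t + t)) (*-distribʳ-sum m a) ⟩
    D + (∑[ i < n ] (a i * m) + ∑[ i < n ] (a i * m))
      ≡⟨ sum-square-sub a (λ _ → m) ⟩
    ∑[ i < n ] (a i * a i) + ∑[ i < n ] (m * m)
      ≡⟨ cong (∑[ i < n ] (a i * a i) +_) (trans (sum-const n (m * m)) mean-square) ⟩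
    ∑[ i < n ] (a i * a i) + S * m
      ∎)
  where
    open ≡-Reasoning
    open ℚ-Solver.+-*-Solver
    S m D : ℚ
    S = ∑[ i < n ] a i
    m = ratio 1 n * S
    D = ∑[ i < n ] ((a i - m) * (a i - m))
    mean-square : ℕtoℚ n * (m * m) ≡ S * m
    mean-square = begin
      ℕtoℚ n * (m * m)                  ≡⟨ solve 3 (λ N r S → N :* ((r :* S) :* (r :* S)) := (N :* r) :* (S :* (r :* S))) refl (ℕtoℚ n) (ratio 1 n) S ⟩
      (ℕtoℚ n * ratio 1 n) * (S * m)    ≡⟨ cong (_* (S * m)) (ℕtoℚ-*-ratio 1 n) ⟩
      1ℚ * (S * m)                      ≡⟨ ℚₚ.*-identityˡ (S * m) ⟩
      S * m                             ∎

sum-squares≥square-sum/n : ∀ {n} .{{_ : NonZero n}} (a : Fin n → ℚ) →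
  ratio 1 n * (∑[ i < n ] a i * ∑[ i < n ] a i) ≤ ∑[ i < n ] (a i * a i)
sum-squares≥square-sum/n {n} a = begin
  ratio 1 n * (S * S)    ≡⟨ solve 2 (λ r S → r :* (S :* S) := con 0ℚ :+ S :* (r :* S)) refl (ratio 1 n) S ⟩
  0ℚ + S * m             ≤⟨ ℚₚ.+-monoˡ-≤ (S * m) (sum-nonNeg _ (λ i → 0≤p*p (a i - m))) ⟩
  D + S * m              ≡⟨ sum-squares≡sum-squares-about-mean a ⟨
  ∑[ i < n ] (a i * a i) ∎
  where
    open ℚₚ.≤-Reasoning
    open ℚ-Solver.+-*-Solver
    S m D : ℚ
    S = ∑[ i < n ] a i
    m = ratio 1 n * S
    D = ∑[ i < n ] ((a i - m) * (a i - m))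

sum-squares≡square-sum/n : ∀ {n} .{{_ : NonZero n}} (a : Fin n → ℚ) c → (∀ i → ∣ a i ∣ ≡ c) →
  ∑[ i < n ] (a i * a i) ≡ ratio 1 n * (∑[ i < n ] ∣ a i ∣ * ∑[ i < n ] ∣ a i ∣)
sum-squares≡square-sum/n {n} a c ∣a∣≡c = begin
  ∑[ i < n ] (a i * a i)                     ≡⟨ sum-cong-≗ (λ i → trans (sym (∣p∣*∣p∣≡p*p (a i))) (cong (λ t → t * t) (∣a∣≡c i))) ⟩
  ∑[ i < n ] (c * c)                         ≡⟨ sum-const n (c * c) ⟩
  ℕtoℚ n * (c * c)                           ≡⟨ ℚₚ.*-identityˡ _ ⟨
  1ℚ * (ℕtoℚ n * (c * c))                    ≡⟨ cong (_* (ℕtoℚ n * (c * c))) (ℕtoℚ-*-ratio 1 n) ⟨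
  (ℕtoℚ n * ratio 1 n) * (ℕtoℚ n * (c * c))  ≡⟨ solve 3 (λ N r c → (N :* r) :* (N :* (c :* c)) := r :* ((N :* c) :* (N :* c))) refl (ℕtoℚ n) (ratio 1 n) c ⟩
  ratio 1 n * ((ℕtoℚ n * c) * (ℕtoℚ n * c))  ≡⟨ cong (λ t → ratio 1 n * (t * t)) (trans (sum-cong-≗ ∣a∣≡c) (sum-const n c)) ⟨
  ratio 1 n * (∑[ i < n ] ∣ a i ∣ * ∑[ i < n ] ∣ a i ∣) ∎
  where
    open ≡-Reasoning
    open ℚ-Solver.+-*-Solver

module _ {n : ℕ} (G : Graph n) where

  neighbourDegreeSum : Fin n → ℕ
  neighbourDegreeSum i = sumℕ (λ j → if adj G i j then degree G j else 0)

  sum-if-adj : ∀ i k → sumℕ (λ j → if adj G i j then k else 0) ≡ k ℕ.* degree G i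
  sum-if-adj i k = begin
    sumℕ (λ j → if adj G i j then k else 0)                    ≡⟨ sumℕ≡sum (λ j → if adj G i j then k else 0) ⟩
    ℕ-Sum.sum (λ j → if adj G i j then k else 0)               ≡⟨ ℕ-Sum.sum-cong-≗ (λ j → if-then-0≡*-if-then-1 (adj G i j) k) ⟩
    ℕ-Sum.sum (λ j → k ℕ.* (if adj G i j then 1 else 0))       ≡⟨ ℕ-Sum.*-distribˡ-sum k (λ j → if adj G i j then 1 else 0) ⟨
    k ℕ.* ℕ-Sum.sum (λ j → if adj G i j then 1 else 0)         ≡⟨ cong (k ℕ.*_) (sumℕ≡sum (λ j → if adj G i j then 1 else 0)) ⟨
    k ℕ.* degree G i                                           ∎
    where open ≡-Reasoning

  -- Each vertex j is counted once for every neighbour, that is d_j times.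
  sum-neighbourDegreeSum≡M1 : sumℕ neighbourDegreeSum ≡ M1 G
  sum-neighbourDegreeSum≡M1 = begin
    sumℕ neighbourDegreeSum                              ≡⟨ sumℕ≡sum neighbourDegreeSum ⟩
    ℕ-Sum.sum neighbourDegreeSum                         ≡⟨ ℕ-Sum.sum-cong-≗ (λ i → sumℕ≡sum (w i)) ⟩
    ℕ-Sum.sum (λ i → ℕ-Sum.sum (λ j → w i j))            ≡⟨ ℕ-Sum.∑-comm w ⟩
    ℕ-Sum.sum (λ j → ℕ-Sum.sum (λ i → w i j))            ≡⟨ ℕ-Sum.sum-cong-≗ column ⟩
    ℕ-Sum.sum (λ j → degree G j ℕ.* degree G j)          ≡⟨ sumℕ≡sum (λ j → degree G j ℕ.* degree G j) ⟨
    M1 G                                                 ∎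
    where
      open ≡-Reasoning
      w : Fin n → Fin n → ℕ
      w i j = if adj G i j then degree G j else 0
      column : ∀ j → ℕ-Sum.sum (λ i → w i j) ≡ degree G j ℕ.* degree G j
      column j = begin
        ℕ-Sum.sum (λ i → w i j)                                  ≡⟨ ℕ-Sum.sum-cong-≗ (λ i → cong (λ b → if b then degree G j else 0) (symm G i j)) ⟩
        ℕ-Sum.sum (λ i → if adj G j i then degree G j else 0)    ≡⟨ sumℕ≡sum (λ i → if adj G j i then degree G j else 0) ⟨
        sumℕ (λ i → if adj G j i then degree G j else 0)         ≡⟨ sum-if-adj j (degree G j) ⟩
        degree G j ℕ.* degree G j                                ∎

  degree-*-mu : ∀ i .{{_ : NonZero (degree G i)}} → ℕtoℚ (degree G i) * mu G i ≡ ℕtoℚ (neighbourDegreeSum i)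
  degree-*-mu i = ℕtoℚ-*-ratio (neighbourDegreeSum i) (degree G i)

  mu-of-constant-neighbour-degree : ∀ i k .{{_ : NonZero (degree G i)}} →
    (∀ j → adj G i j ≡ true → degree G j ≡ k) → mu G i ≡ ℕtoℚ k
  mu-of-constant-neighbour-degree i k neighbour-degree = begin
    ratio (neighbourDegreeSum i) (degree G i)    ≡⟨ cong (λ s → ratio s (degree G i)) (trans (sumℕ-cong weight) (sum-if-adj i k)) ⟩
    ratio (k ℕ.* degree G i) (degree G i)        ≡⟨ ratio-*-cancel k (degree G i) ⟩
    ℕtoℚ k                                       ∎
    where
      open ≡-Reasoning
      weight : ∀ j → (if adj G i j then degree G j else 0) ≡ (if adj G i j then k else 0)
      weight j with adj G i j in i~j
      ... | true  = neighbour-degree j i~j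
      ... | false = refl

  adj⇒degree-nonZero : ∀ {i k} → adj G i k ≡ true → NonZero (degree G i)
  adj⇒degree-nonZero {i} {k} i~k = ℕ.>-nonZero (begin-strict
    0                                                <⟨ s≤s z≤n ⟩
    1                                                ≡⟨ cong (λ b → if b then 1 else 0) i~k ⟨
    (if adj G i k then 1 else 0)                     ≤⟨ term≤sum (λ j → if adj G i j then 1 else 0) k ⟩
    ℕ-Sum.sum (λ j → if adj G i j then 1 else 0)     ≡⟨ sumℕ≡sum (λ j → if adj G i j then 1 else 0) ⟨
    degree G i                                       ∎)
    where open ℕₚ.≤-Reasoning

  reach⇒neighbour : ∀ {i j} → Reach G i j → i ≢ j → ∃ λ k → adj G i k ≡ true
  reach⇒neighbour here            i≢i = ⊥-elim (i≢i refl)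
  reach⇒neighbour (step {k = k} i~k _) _ = k , i~k

  deviation : Fin n → ℚ
  deviation i = ℕtoℚ (degree G i) - mu G i

  module _ (degree≢0 : ∀ i → NonZero (degree G i)) where

    sum-degree-*-mu : ∑[ i < n ] (ℕtoℚ (degree G i) * mu G i) ≡ ℕtoℚ (M1 G)
    sum-degree-*-mu = begin
      ∑[ i < n ] (ℕtoℚ (degree G i) * mu G i)     ≡⟨ sum-cong-≗ (λ i → degree-*-mu i {{degree≢0 i}}) ⟩
      ∑[ i < n ] ℕtoℚ (neighbourDegreeSum i)      ≡⟨ ℕtoℚ-sum neighbourDegreeSum ⟨
      ℕtoℚ (ℕ-Sum.sum neighbourDegreeSum)         ≡⟨ cong ℕtoℚ (trans (sym (sumℕ≡sum neighbourDegreeSum)) sum-neighbourDegreeSum≡M1) ⟩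
      ℕtoℚ (M1 G)                                 ∎
      where open ≡-Reasoning

    sum-degree² : ∑[ i < n ] (ℕtoℚ (degree G i) * ℕtoℚ (degree G i)) ≡ ℕtoℚ (M1 G)
    sum-degree² = begin
      ∑[ i < n ] (ℕtoℚ (degree G i) * ℕtoℚ (degree G i))   ≡⟨ sum-cong-≗ (λ i → ℕtoℚ-homo-* (degree G i) (degree G i)) ⟨
      ∑[ i < n ] ℕtoℚ (degree G i ℕ.* degree G i)          ≡⟨ ℕtoℚ-sum (λ i → degree G i ℕ.* degree G i) ⟨
      ℕtoℚ (ℕ-Sum.sum (λ i → degree G i ℕ.* degree G i))   ≡⟨ cong ℕtoℚ (sumℕ≡sum (λ i → degree G i ℕ.* degree G i)) ⟨
      ℕtoℚ (M1 G)                                          ∎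
      where open ≡-Reasoning

    sum-mu²≡sum-deviation²+M1 :
      ∑[ i < n ] (mu G i * mu G i) ≡ ∑[ i < n ] (deviation i * deviation i) + ℕtoℚ (M1 G)
    sum-mu²≡sum-deviation²+M1 = x+[y+y]≡z+y⇒z≡x+y D M (∑[ i < n ] (μ i * μ i)) (begin
      D + (M + M)                                  ≡⟨ cong (λ t → D + (t + t)) sum-degree-*-mu ⟨
      D + (∑[ i < n ] (d i * μ i) + ∑[ i < n ] (d i * μ i))
                                                   ≡⟨ sum-square-sub d μ ⟩
      ∑[ i < n ] (d i * d i) + ∑[ i < n ] (μ i * μ i)
                                                   ≡⟨ cong (_+ ∑[ i < n ] (μ i * μ i)) sum-degree² ⟩
      M + ∑[ i < n ] (μ i * μ i)                   ≡⟨ ℚₚ.+-comm M _ ⟩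
      ∑[ i < n ] (μ i * μ i) + M                   ∎)
      where
        open ≡-Reasoning
        d μ : Fin n → ℚ
        d i = ℕtoℚ (degree G i)
        μ = mu G
        M D : ℚ
        M = ℕtoℚ (M1 G)
        D = ∑[ i < n ] ((d i - μ i) * (d i - μ i))

    mu-of-bipartite : (side : Fin n → Bool) → (∀ i j → adj G i j ≡ true → side i ≡ side j → ⊥) →
      (∀ i j → side i ≡ side j → degree G i ≡ degree G j) →
      ∀ i k → side k ≢ side i → mu G i ≡ ℕtoℚ (degree G k)
    mu-of-bipartite side bipartite side-degree i k sk≢si =
      mu-of-constant-neighbour-degree i (degree G k) {{degree≢0 i}}
        (λ j i~j → side-degree j k (x≢z∧y≢z⇒x≡y (λ sj≡si → bipartite i j i~j (sym sj≡si)) sk≢si))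

    ∣deviation∣-constant : Regular G ⊎ Semiregular G → ∃ λ c → ∀ i → ∣ deviation i ∣ ≡ c
    ∣deviation∣-constant (inj₁ (k , regular)) = ∣ ℕtoℚ k - ℕtoℚ k ∣ , λ i →
      cong₂ (λ a b → ∣ a - b ∣) (cong ℕtoℚ (regular i))
        (mu-of-constant-neighbour-degree i k {{degree≢0 i}} (λ j _ → regular j))
    ∣deviation∣-constant (inj₂ (_ , side , Δ , δ , Δ>δ , bipartite , (p , dp≡Δ) , (q , dq≡δ) , _ , side-degree)) =
      ∣ ℕtoℚ Δ - ℕtoℚ δ ∣ , ∣d-μ∣≡∣Δ-δ∣
      where
        sp≢sq : side p ≢ side q
        sp≢sq sp≡sq = ℕₚ.>⇒≢ Δ>δ (trans (sym dp≡Δ) (trans (side-degree p q sp≡sq) dq≡δ))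
        μ≡ : ∀ i k → side k ≢ side i → mu G i ≡ ℕtoℚ (degree G k)
        μ≡ = mu-of-bipartite side bipartite side-degree
        ∣d-μ∣≡∣Δ-δ∣ : ∀ i → ∣ deviation i ∣ ≡ ∣ ℕtoℚ Δ - ℕtoℚ δ ∣
        ∣d-μ∣≡∣Δ-δ∣ i with side i ≟ side p
        ... | yes si≡sp = cong₂ (λ a b → ∣ a - b ∣)
              (cong ℕtoℚ (trans (side-degree i p si≡sp) dp≡Δ))
              (trans (μ≡ i q (λ sq≡si → sp≢sq (sym (trans sq≡si si≡sp)))) (cong ℕtoℚ dq≡δ))
        ... | no si≢sp = trans (cong₂ (λ a b → ∣ a - b ∣)
              (cong ℕtoℚ (trans (side-degree i q (x≢z∧y≢z⇒x≡y si≢sp (sp≢sq ∘ sym))) dq≡δ))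
              (trans (μ≡ i p (si≢sp ∘ sym)) (cong ℕtoℚ dp≡Δ)))
              (∣p-q∣≡∣q-p∣ (ℕtoℚ δ) (ℕtoℚ Δ))


    mu-square-sum-lower-bound : .{{_ : NonZero n}} →
      ratio 1 n * (∑[ i < n ] ∣ deviation i ∣ * ∑[ i < n ] ∣ deviation i ∣) + ℕtoℚ (M1 G)
        ≤ ∑[ i < n ] (mu G i * mu G i)
    mu-square-sum-lower-bound = begin
      ratio 1 n * (∑[ i < n ] ∣ deviation i ∣ * ∑[ i < n ] ∣ deviation i ∣) + M
        ≤⟨ ℚₚ.+-monoˡ-≤ M (sum-squares≥square-sum/n (∣_∣ ∘ deviation)) ⟩
      ∑[ i < n ] (∣ deviation i ∣ * ∣ deviation i ∣) + M
        ≡⟨ cong (_+ M) (sum-cong-≗ (∣p∣*∣p∣≡p*p ∘ deviation)) ⟩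
      ∑[ i < n ] (deviation i * deviation i) + M
        ≡⟨ sum-mu²≡sum-deviation²+M1 ⟨
      ∑[ i < n ] (mu G i * mu G i)
        ∎
      where
        open ℚₚ.≤-Reasoning
        M : ℚ
        M = ℕtoℚ (M1 G)

    mu-square-sum-lower-bound-attained : .{{_ : NonZero n}} → Regular G ⊎ Semiregular G →
      ∑[ i < n ] (mu G i * mu G i)
        ≡ ratio 1 n * (∑[ i < n ] ∣ deviation i ∣ * ∑[ i < n ] ∣ deviation i ∣) + ℕtoℚ (M1 G)
    mu-square-sum-lower-bound-attained = attained ∘ ∣deviation∣-constant
      where
        attained : (∃ λ c → ∀ i → ∣ deviation i ∣ ≡ c) →
          ∑[ i < n ] (mu G i * mu G i)
            ≡ ratio 1 n * (∑[ i < n ] ∣ deviation i ∣ * ∑[ i < n ] ∣ deviation i ∣) + ℕtoℚ (M1 G)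
        attained (c , ∣deviation∣≡c) = trans sum-mu²≡sum-deviation²+M1
          (cong (_+ ℕtoℚ (M1 G)) (sum-squares≡square-sum/n deviation c ∣deviation∣≡c))

connected⇒degree-nonZero : ∀ {m} (G : Graph (ℕ.suc (ℕ.suc m))) → Connected G → ∀ i → NonZero (degree G i)
connected⇒degree-nonZero G connected i with reach⇒neighbour G (connected i (punchIn i zero)) (punchInᵢ≢i i zero ∘ sym)
... | k , i~k = adj⇒degree-nonZero G i~k

proposition7 : ∀ (n : ℕ) → n ≥ 3 → (G : Graph n) → Connected G →
    ((ratio 1 n * (sumℚ (λ i → ∣ ℕtoℚ (degree G i) - mu G i ∣) * sumℚ (λ i → ∣ ℕtoℚ (degree G i) - mu G i ∣)) + ℕtoℚ (M1 G))
      ≤ sumℚ (λ i → mu G i * mu G i))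
    × (Regular G ⊎ Semiregular G →
       sumℚ (λ i → mu G i * mu G i)
         ≡ (ratio 1 n * (sumℚ (λ i → ∣ ℕtoℚ (degree G i) - mu G i ∣) * sumℚ (λ i → ∣ ℕtoℚ (degree G i) - mu G i ∣)) + ℕtoℚ (M1 G)))
proposition7 n@(ℕ.suc (ℕ.suc _)) (s≤s (s≤s _)) G connected =
    subst₂ lower-bound (sym sum-∣deviation∣) (sym sum-mu²) (mu-square-sum-lower-bound G degree≢0)
  , subst₂ attained (sym sum-∣deviation∣) (sym sum-mu²) ∘ mu-square-sum-lower-bound-attained G degree≢0
  where
    degree≢0 : ∀ i → NonZero (degree G i)
    degree≢0 = connected⇒degree-nonZero G connected
    lower-bound attained : ℚ → ℚ → Set
    lower-bound s t = ratio 1 n * (s * s) + ℕtoℚ (M1 G) ≤ t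
    attained s t = t ≡ ratio 1 n * (s * s) + ℕtoℚ (M1 G)
    sum-∣deviation∣ : sumℚ (λ i → ∣ deviation G i ∣) ≡ ∑[ i < n ] ∣ deviation G i ∣
    sum-∣deviation∣ = sumℚ≡sum (λ i → ∣ deviation G i ∣)
    sum-mu² : sumℚ (λ i → mu G i * mu G i) ≡ ∑[ i < n ] (mu G i * mu G i)
    sum-mu² = sumℚ≡sum (λ i → mu G i * mu G i)
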